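{- For every positive integer $i$, \[ \begin{aligned} C_{3(i-1)}^{(3)}&=\tfrac{1}{8}\Big((i+1)(2i^2+i+1)-\tfrac{1}{2}(1+(-1)^i)\Big),\\ C_{3(i-1)+1}^{(3)}&=\tfrac{1}{8}\Big((i+1)(2i^2+3i-1)+\tfrac{1}{2}(1+(-1)^i)\Big),\\ C_{3(i-1)+2}^{(3)}&=\tfrac{1}{8}\Big((i+1)(2i^2+5i+1)-\tfrac{1}{2}(1+(-1)^i)\Big). \end{aligned} \]
   Context: $\Lambda_3=\mathbb{Z}_{\geq0}^3$, $\mathbf e(1)=(1,0,0)$; $X_3=\{(1,-2,0),(-2,1,0),(-1,-1,1),(0,0,-1)\}$; for $\mathbf{v},\mathbf{w}\in\Lambda_3$, $\mathbf{v}\lessdot\mathbf{w}$ iff $\mathbf{v}-\mathbf{w}\in X_3$; $\prec$ is the transitive closure of $\lessdot$ on $\Lambda_3$ (chains staying in $\Lambda_3$). $C_n^{(3)}=|\{n\mathbf{e}(1)\}\cup\{\mathbf w\in\Lambda_3:\mathbf w\prec n\mathbf{e}(1)\}|$. -}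

module Defs where

open import Data.Nat using (ℕ; zero; suc)
open import Data.Integer as ℤ using (ℤ; +_; -[1+_])
open import Data.Product using (_×_; _,_; Σ)
open import Data.Sum using (_⊎_)
open import Data.List using (List; length)
open import Data.List.Membership.Propositional using (_∈_)
open import Data.List.Relation.Unary.Unique.Propositional using (Unique)
open import Function.Bundles using (_⇔_)
open import Relation.Binary.PropositionalEquality using (_≡_)
open import Relation.Binary.Construct.Closure.Transitive using (TransClosure)

Λ₃ : Set
Λ₃ = ℕ × ℕ × ℕ

ℤ³ : Set
ℤ³ = ℤ × ℤ × ℤ

toℤ³ : Λ₃ → ℤ³
toℤ³ (a , b , c) = (+ a , + b , + c)

_-³_ : ℤ³ → ℤ³ → ℤ³
(a , b , c) -³ (a' , b' , c') = (a ℤ.- a' , b ℤ.- b' , c ℤ.- c')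

data InX₃ : ℤ³ → Set where
  x₁ : InX₃ (+ 1 , ℤ.- (+ 2) , + 0)
  x₂ : InX₃ (ℤ.- (+ 2) , + 1 , + 0)
  x₃ : InX₃ (ℤ.- (+ 1) , ℤ.- (+ 1) , + 1)
  x₄ : InX₃ (+ 0 , + 0 , ℤ.- (+ 1))

_⋖_ : Λ₃ → Λ₃ → Set
v ⋖ w = InX₃ (toℤ³ v -³ toℤ³ w)

-- ≺ : transitive closure of ⋖ on Λ₃ (chains stay in Λ₃ automatically)
_≺_ : Λ₃ → Λ₃ → Set
_≺_ = TransClosure _⋖_

ne₁ : ℕ → Λ₃
ne₁ n = (n , 0 , 0)

S : ℕ → Λ₃ → Set
S n w = (w ≡ ne₁ n) ⊎ (w ≺ ne₁ n)

HasCard : (Λ₃ → Set) → ℕ → Set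
HasCard P k = Σ (List Λ₃) λ L → Unique L × (∀ w → (w ∈ L) ⇔ P w) × (length L ≡ k)

C≡ : ℕ → ℕ → Set
C≡ n k = HasCard (S n) k

-- Every vector of X₃ changes the weight a + 2b + 3c by 0 or −3, so every w ≺ n e(1) has weight at
-- most n and congruent to n mod 3. Conversely every such w climbs to n e(1): trade each c for an a
-- and a b, then each b for two a's, then raise a three at a time through (a,0,1) and (a+1,1,0).
-- So C_n counts the triples with a + 2b + 3c ≤ n and ≡ n (mod 3). Splitting off c = 0, and then the
-- pairs of exact weight, gives C(n+3) = A(n+3) + C(n), A(n+3) = P(n+3) + A(n), P(n+2) = P(n) + 1,
-- which are solved in closed form along n = 6j + r; r < 3 is the case of odd i, r ≥ 3 that of even i.
module Submission where

open import Defs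
open import Data.Nat as ℕ using (ℕ; zero; suc; _≤_; _∸_)
import Data.Nat.Properties as ℕ
import Data.Nat
import Data.Nat.Tactic.RingSolver as ℕ-Solver
open import Data.Integer using (ℤ; +_; _+_; _-_; _*_; -_; _^_)
import Data.Integer.Properties as ℤ
import Data.Integer.Tactic.RingSolver as ℤ-Solver
open import Data.Product using (Σ; _×_; _,_)
open import Data.Sum using (_⊎_; inj₁; inj₂)
open import Relation.Nullary using (¬_)
open import Data.List using (List; []; _∷_; map; _++_; length)
open import Data.List.Properties using (length-map; length-++)
open import Data.List.Relation.Unary.Any using (here; there)
open import Data.List.Relation.Unary.All as All using ()
open import Data.List.Relation.Unary.AllPairs using ([]; _∷_)
open import Data.List.Membership.Propositional using (_∈_)
open import Data.List.Membership.Propositional.Properties using (∈-map⁺; ∈-map⁻; ∈-++⁺ˡ; ∈-++⁺ʳ; ∈-++⁻)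
open import Data.List.Relation.Unary.Unique.Propositional using (Unique)
import Data.List.Relation.Unary.Unique.Propositional.Properties as Unique
open import Function.Bundles using (_⇔_; mk⇔; Equivalence)
open import Relation.Binary.PropositionalEquality
open import Relation.Binary.Construct.Closure.Transitive using ([_]; _∷_) renaming (_++_ to _++⁺_)
open ≡-Reasoning

weight : Λ₃ → ℕ
weight (a , b , c) = a ℕ.+ 2 ℕ.* b ℕ.+ 3 ℕ.* c

weightℤ : ℤ³ → ℤ
weightℤ (x , y , z) = x + + 2 * y + + 3 * z

weightℤ-toℤ³ : ∀ v → weightℤ (toℤ³ v) ≡ + weight v
weightℤ-toℤ³ (a , b , c) = sym (begin
  + (a ℕ.+ 2 ℕ.* b ℕ.+ 3 ℕ.* c)   ≡⟨ ℤ.pos-+ (a ℕ.+ 2 ℕ.* b) (3 ℕ.* c) ⟩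
  + (a ℕ.+ 2 ℕ.* b) + + (3 ℕ.* c) ≡⟨ cong₂ _+_ (ℤ.pos-+ a (2 ℕ.* b)) (ℤ.pos-* 3 c) ⟩
  + a + + (2 ℕ.* b) + + 3 * + c   ≡⟨ cong (λ y → + a + y + + 3 * + c) (ℤ.pos-* 2 b) ⟩
  + a + + 2 * + b + + 3 * + c     ∎)

weightℤ-linear : ∀ s t → weightℤ (s -³ t) ≡ weightℤ s - weightℤ t
weightℤ-linear (x , y , z) (x′ , y′ , z′) = linear x y z x′ y′ z′
  where
  linear : ∀ x y z x′ y′ z′ →
    (x - x′) + + 2 * (y - y′) + + 3 * (z - z′) ≡ (x + + 2 * y + + 3 * z) - (x′ + + 2 * y′ + + 3 * z′)
  linear = ℤ-Solver.solve-∀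

weightℤ-X₃ : ∀ {t} → InX₃ t → Σ ℕ λ k → weightℤ t ≡ - + (3 ℕ.* k)
weightℤ-X₃ x₁ = 1 , refl
weightℤ-X₃ x₂ = 0 , refl
weightℤ-X₃ x₃ = 0 , refl
weightℤ-X₃ x₄ = 1 , refl

infix 4 _≤₃_
record _≤₃_ (m n : ℕ) : Set where
  constructor steps
  field
    count : ℕ
    sum   : m ℕ.+ 3 ℕ.* count ≡ n

≡⇒≤₃ : ∀ {m n} → m ≡ n → m ≤₃ n
≡⇒≤₃ {m} refl = steps 0 (ℕ.+-identityʳ m)

≤₃-trans : ∀ {l m n} → l ≤₃ m → m ≤₃ n → l ≤₃ n
≤₃-trans {l} (steps k refl) (steps k′ refl) = steps (k ℕ.+ k′) (regroup l k k′)
  where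
  regroup : ∀ l k k′ → l ℕ.+ 3 ℕ.* (k ℕ.+ k′) ≡ l ℕ.+ 3 ℕ.* k ℕ.+ 3 ℕ.* k′
  regroup = ℕ-Solver.solve-∀

≤₃-3+ : ∀ {m n} → m ≤₃ n → 3 ℕ.+ m ≤₃ 3 ℕ.+ n
≤₃-3+ (steps k e) = steps k (cong (3 ℕ.+_) e)

≤₃-step : ∀ {m n} → m ≤₃ n → m ≤₃ 3 ℕ.+ n
≤₃-step {n = n} mn = ≤₃-trans mn (steps 1 (ℕ.+-comm n 3))

3+n≰₃n : ∀ n → ¬ (3 ℕ.+ n ≤₃ n)
3+n≰₃n n (steps k e) = ℕ.m+1+n≢m n (trans (shuffle n k) e)
  where
  shuffle : ∀ n k → n ℕ.+ suc (2 ℕ.+ 3 ℕ.* k) ≡ 3 ℕ.+ n ℕ.+ 3 ℕ.* k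
  shuffle = ℕ-Solver.solve-∀

difference-neg : ∀ x y z → x - y ≡ - z → y ≡ x + z
difference-neg x y z e = begin
  y           ≡⟨ cancel x y ⟨
  x - (x - y) ≡⟨ cong (_-_ x) e ⟩
  x - - z     ≡⟨ cong (_+_ x) (ℤ.neg-involutive z) ⟩
  x + z       ∎
  where
  cancel : ∀ x y → x - (x - y) ≡ y
  cancel = ℤ-Solver.solve-∀

⋖-weight : ∀ {v w} → v ⋖ w → weight v ≤₃ weight w
⋖-weight {v} {w} v⋖w with weightℤ-X₃ v⋖w
... | k , drop = steps k (ℤ.+-injective (sym (begin
  + weight w                  ≡⟨ difference-neg (+ weight v) (+ weight w) (+ (3 ℕ.* k)) weights ⟩
  + weight v + + (3 ℕ.* k)     ≡⟨ ℤ.pos-+ (weight v) (3 ℕ.* k) ⟨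
  + (weight v ℕ.+ 3 ℕ.* k)     ∎)))
  where
  weights : + weight v - + weight w ≡ - + (3 ℕ.* k)
  weights = begin
    + weight v - + weight w                         ≡⟨ cong₂ _-_ (weightℤ-toℤ³ v) (weightℤ-toℤ³ w) ⟨
    weightℤ (toℤ³ v) - weightℤ (toℤ³ w)            ≡⟨ weightℤ-linear (toℤ³ v) (toℤ³ w) ⟨
    weightℤ (toℤ³ v -³ toℤ³ w)                      ≡⟨ drop ⟩
    - + (3 ℕ.* k)                                   ∎

≺-weight : ∀ {v w} → v ≺ w → weight v ≤₃ weight w
≺-weight ([_] {v} {w} v⋖w)    = ⋖-weight {v} {w} v⋖w
≺-weight (_∷_ {v} {u} v⋖u u≺w) = ≤₃-trans (⋖-weight {v} {u} v⋖u) (≺-weight u≺w)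

infix 4 _≼_
_≼_ : Λ₃ → Λ₃ → Set
v ≼ w = v ≡ w ⊎ v ≺ w

≼-weight : ∀ {v w} → v ≼ w → weight v ≤₃ weight w
≼-weight (inj₁ refl) = ≡⇒≤₃ refl
≼-weight (inj₂ v≺w)  = ≺-weight v≺w

infixr 5 _⋖⟨_⟩_
_⋖⟨_⟩_ : ∀ u {v w} → u ⋖ v → v ≼ w → u ≼ w
u ⋖⟨ u⋖v ⟩ inj₁ refl = inj₂ [ u⋖v ]
u ⋖⟨ u⋖v ⟩ inj₂ v≺w  = inj₂ (u⋖v ∷ v≺w)

≼-trans : ∀ {u v w} → u ≼ v → v ≼ w → u ≼ w
≼-trans (inj₁ refl) v≼w         = v≼w
≼-trans (inj₂ u≺v) (inj₁ refl) = inj₂ u≺v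
≼-trans (inj₂ u≺v) (inj₂ v≺w)  = inj₂ (u≺v ++⁺ v≺w)

pos-difference : ∀ k a → + (k ℕ.+ a) - + a ≡ + k
pos-difference k a = trans (cong (_- + a) (ℤ.pos-+ k a)) (cancel (+ k) (+ a))
  where
  cancel : ∀ x y → x + y - y ≡ x
  cancel = ℤ-Solver.solve-∀

pos-difference′ : ∀ k a → + a - + (k ℕ.+ a) ≡ - + k
pos-difference′ k a = trans (cong (_-_ (+ a)) (ℤ.pos-+ k a)) (cancel (+ k) (+ a))
  where
  cancel : ∀ x y → y - (x + y) ≡ - x
  cancel = ℤ-Solver.solve-∀

coordinates : ∀ {x y z x′ y′ z′ : ℤ} → x ≡ x′ → y ≡ y′ → z ≡ z′ → (x , y , z) ≡ (x′ , y′ , z′)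
coordinates ex ey ez = cong₂ _,_ ex (cong₂ _,_ ey ez)

⋖-lowerC : ∀ a b c → (a , b , suc c) ⋖ (suc a , suc b , c)
⋖-lowerC a b c =
  subst InX₃ (sym (coordinates (pos-difference′ 1 a) (pos-difference′ 1 b) (pos-difference 1 c))) x₃

⋖-lowerB : ∀ a b → (a , suc b , 0) ⋖ (2 ℕ.+ a , b , 0)
⋖-lowerB a b = subst InX₃ (sym (coordinates (pos-difference′ 2 a) (pos-difference 1 b) refl)) x₂

⋖-raiseC : ∀ a → (a , 0 , 0) ⋖ (a , 0 , 1)
⋖-raiseC a = subst InX₃ (sym (coordinates (pos-difference 0 a) refl refl)) x₄

≼-flattenC : ∀ a b c → (a , b , c) ≼ (c ℕ.+ a , c ℕ.+ b , 0)
≼-flattenC a b zero    = inj₁ refl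
≼-flattenC a b (suc c) = (a , b , suc c) ⋖⟨ ⋖-lowerC a b c ⟩
  subst₂ (λ x y → (suc a , suc b , c) ≼ (x , y , 0)) (ℕ.+-suc c a) (ℕ.+-suc c b) (≼-flattenC (suc a) (suc b) c)

≼-flattenB : ∀ a b → (a , b , 0) ≼ (2 ℕ.* b ℕ.+ a , 0 , 0)
≼-flattenB a zero    = inj₁ refl
≼-flattenB a (suc b) = (a , suc b , 0) ⋖⟨ ⋖-lowerB a b ⟩
  subst (λ x → (2 ℕ.+ a , b , 0) ≼ (x , 0 , 0)) (shift a b) (≼-flattenB (2 ℕ.+ a) b)
  where
  shift : ∀ a b → 2 ℕ.* b ℕ.+ (2 ℕ.+ a) ≡ 2 ℕ.* suc b ℕ.+ a
  shift = ℕ-Solver.solve-∀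

≼-raise : ∀ a k → (a , 0 , 0) ≼ (3 ℕ.* k ℕ.+ a , 0 , 0)
≼-raise a zero    = inj₁ refl
≼-raise a (suc k) =
  (a , 0 , 0)     ⋖⟨ ⋖-raiseC a ⟩
  (a , 0 , 1)     ⋖⟨ ⋖-lowerC a 0 0 ⟩
  (suc a , 1 , 0) ⋖⟨ ⋖-lowerB (suc a) 0 ⟩
  subst (λ x → (3 ℕ.+ a , 0 , 0) ≼ (x , 0 , 0)) (shift a k) (≼-raise (3 ℕ.+ a) k)
  where
  shift : ∀ a k → 3 ℕ.* k ℕ.+ (3 ℕ.+ a) ≡ 3 ℕ.* suc k ℕ.+ a
  shift = ℕ-Solver.solve-∀

≤₃⇒≼ : ∀ {w n} → weight w ≤₃ n → w ≼ ne₁ n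
≤₃⇒≼ {a , b , c} (steps k refl) =
  ≼-trans (≼-flattenC a b c) (≼-trans (≼-flattenB (c ℕ.+ a) (c ℕ.+ b))
    (subst (λ x → (2 ℕ.* (c ℕ.+ b) ℕ.+ (c ℕ.+ a) , 0 , 0) ≼ (x , 0 , 0)) (collect a b c k) (≼-raise _ k)))
  where
  collect : ∀ a b c k →
    3 ℕ.* k ℕ.+ (2 ℕ.* (c ℕ.+ b) ℕ.+ (c ℕ.+ a)) ≡ a ℕ.+ 2 ℕ.* b ℕ.+ 3 ℕ.* c ℕ.+ 3 ℕ.* k
  collect = ℕ-Solver.solve-∀

S⇔weight≤₃ : ∀ n w → S n w ⇔ weight w ≤₃ n
S⇔weight≤₃ n w = mk⇔ (λ w≼n → subst (weight w ≤₃_) (weight-ne₁ n) (≼-weight w≼n)) ≤₃⇒≼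
  where
  weight-ne₁ : ∀ n → weight (ne₁ n) ≡ n
  weight-ne₁ n = trans (ℕ.+-identityʳ (n ℕ.+ 0)) (ℕ.+-identityʳ n)

weight₂ : ℕ × ℕ → ℕ
weight₂ (a , b) = a ℕ.+ 2 ℕ.* b

incB : ℕ × ℕ → ℕ × ℕ
incB (a , b) = (a , suc b)

incB-injective : ∀ {x y} → incB x ≡ incB y → x ≡ y
incB-injective refl = refl

weight₂-incB : ∀ x → weight₂ (incB x) ≡ 2 ℕ.+ weight₂ x
weight₂-incB (a , b) = shift a b
  where
  shift : ∀ a b → a ℕ.+ 2 ℕ.* suc b ≡ 2 ℕ.+ (a ℕ.+ 2 ℕ.* b)
  shift = ℕ-Solver.solve-∀

pairsOfWeight : ℕ → List (ℕ × ℕ)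
pairsOfWeight zero          = (0 , 0) ∷ []
pairsOfWeight (suc zero)    = (1 , 0) ∷ []
pairsOfWeight (suc (suc m)) = (2 ℕ.+ m , 0) ∷ map incB (pairsOfWeight m)

pairsOfWeight-sound : ∀ m {x} → x ∈ pairsOfWeight m → weight₂ x ≡ m
pairsOfWeight-sound zero          (here refl) = refl
pairsOfWeight-sound (suc zero)    (here refl) = refl
pairsOfWeight-sound (suc (suc m)) (here refl) = ℕ.+-identityʳ (2 ℕ.+ m)
pairsOfWeight-sound (suc (suc m)) (there x∈) with ∈-map⁻ incB x∈
... | x , x∈′ , refl = trans (weight₂-incB x) (cong (2 ℕ.+_) (pairsOfWeight-sound m x∈′))

pairsOfWeight-head : ∀ m → (m , 0) ∈ pairsOfWeight m
pairsOfWeight-head zero          = here refl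
pairsOfWeight-head (suc zero)    = here refl
pairsOfWeight-head (suc (suc m)) = here refl

pairsOfWeight-complete : ∀ x → x ∈ pairsOfWeight (weight₂ x)
pairsOfWeight-complete (a , zero)  =
  subst (λ m → (a , 0) ∈ pairsOfWeight m) (sym (ℕ.+-identityʳ a)) (pairsOfWeight-head a)
pairsOfWeight-complete (a , suc b) =
  subst (λ m → (a , suc b) ∈ pairsOfWeight m) (sym (weight₂-incB (a , b)))
    (there (∈-map⁺ incB (pairsOfWeight-complete (a , b))))

pairsOfWeight-unique : ∀ m → Unique (pairsOfWeight m)
pairsOfWeight-unique zero          = All.[] ∷ []
pairsOfWeight-unique (suc zero)    = All.[] ∷ []
pairsOfWeight-unique (suc (suc m)) =
  All.tabulate head-fresh ∷ Unique.map⁺ incB-injective (pairsOfWeight-unique m)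
  where
  head-fresh : ∀ {y} → y ∈ map incB (pairsOfWeight m) → (2 ℕ.+ m , 0) ≢ y
  head-fresh y∈ with ∈-map⁻ incB y∈
  ... | _ , _ , refl = λ ()

pairsBelow : ℕ → List (ℕ × ℕ)
pairsBelow (suc (suc (suc n))) = pairsOfWeight (3 ℕ.+ n) ++ pairsBelow n
pairsBelow n                   = pairsOfWeight n

three-more : ∀ m k → m ℕ.+ 3 ℕ.* suc k ≡ 3 ℕ.+ (m ℕ.+ 3 ℕ.* k)
three-more = ℕ-Solver.solve-∀

pairsBelow-sound : ∀ n {x} → x ∈ pairsBelow n → weight₂ x ≤₃ n
pairsBelow-sound zero                x∈ = ≡⇒≤₃ (pairsOfWeight-sound 0 x∈)
pairsBelow-sound (suc zero)          x∈ = ≡⇒≤₃ (pairsOfWeight-sound 1 x∈)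
pairsBelow-sound (suc (suc zero))    x∈ = ≡⇒≤₃ (pairsOfWeight-sound 2 x∈)
pairsBelow-sound (suc (suc (suc n))) x∈ with ∈-++⁻ (pairsOfWeight (3 ℕ.+ n)) x∈
... | inj₁ x∈top   = ≡⇒≤₃ (pairsOfWeight-sound (3 ℕ.+ n) x∈top)
... | inj₂ x∈lower = ≤₃-step (pairsBelow-sound n x∈lower)

pairsOfWeight⊆pairsBelow : ∀ n {x} → x ∈ pairsOfWeight n → x ∈ pairsBelow n
pairsOfWeight⊆pairsBelow zero                x∈ = x∈
pairsOfWeight⊆pairsBelow (suc zero)          x∈ = x∈
pairsOfWeight⊆pairsBelow (suc (suc zero))    x∈ = x∈
pairsOfWeight⊆pairsBelow (suc (suc (suc n))) x∈ = ∈-++⁺ˡ x∈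

pairsBelow-complete : ∀ {x n} → weight₂ x ≤₃ n → x ∈ pairsBelow n
pairsBelow-complete {x} (steps zero refl) =
  subst (λ n → x ∈ pairsBelow n) (sym (ℕ.+-identityʳ (weight₂ x)))
    (pairsOfWeight⊆pairsBelow (weight₂ x) (pairsOfWeight-complete x))
pairsBelow-complete {x} (steps (suc k) refl) =
  subst (λ n → x ∈ pairsBelow n) (sym (three-more (weight₂ x) k))
    (∈-++⁺ʳ (pairsOfWeight (3 ℕ.+ (weight₂ x ℕ.+ 3 ℕ.* k))) (pairsBelow-complete (steps k refl)))

pairsBelow-unique : ∀ n → Unique (pairsBelow n)
pairsBelow-unique zero                = pairsOfWeight-unique 0
pairsBelow-unique (suc zero)          = pairsOfWeight-unique 1
pairsBelow-unique (suc (suc zero))    = pairsOfWeight-unique 2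
pairsBelow-unique (suc (suc (suc n))) =
  Unique.++⁺ (pairsOfWeight-unique (3 ℕ.+ n)) (pairsBelow-unique n) disjoint
  where
  disjoint : ∀ {x} → ¬ (x ∈ pairsOfWeight (3 ℕ.+ n) × x ∈ pairsBelow n)
  disjoint (x∈top , x∈lower) =
    3+n≰₃n n (subst (_≤₃ n) (pairsOfWeight-sound (3 ℕ.+ n) x∈top) (pairsBelow-sound n x∈lower))

flat : ℕ × ℕ → Λ₃
flat (a , b) = (a , b , 0)

incC : Λ₃ → Λ₃
incC (a , b , c) = (a , b , suc c)

flat-injective : ∀ {x y} → flat x ≡ flat y → x ≡ y
flat-injective refl = refl

incC-injective : ∀ {v w} → incC v ≡ incC w → v ≡ w
incC-injective refl = refl

weight-flat : ∀ x → weight (flat x) ≡ weight₂ x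
weight-flat x = ℕ.+-identityʳ (weight₂ x)

weight-incC : ∀ w → weight (incC w) ≡ 3 ℕ.+ weight w
weight-incC (a , b , c) = shift a b c
  where
  shift : ∀ a b c → a ℕ.+ 2 ℕ.* b ℕ.+ 3 ℕ.* suc c ≡ 3 ℕ.+ (a ℕ.+ 2 ℕ.* b ℕ.+ 3 ℕ.* c)
  shift = ℕ-Solver.solve-∀

triplesBelow : ℕ → List Λ₃
triplesBelow (suc (suc (suc n))) = map flat (pairsBelow (3 ℕ.+ n)) ++ map incC (triplesBelow n)
triplesBelow n                   = map flat (pairsBelow n)

flat-sound : ∀ n {w} → w ∈ map flat (pairsBelow n) → weight w ≤₃ n
flat-sound n w∈ with ∈-map⁻ flat w∈
... | x , x∈ , refl = subst (_≤₃ n) (sym (weight-flat x)) (pairsBelow-sound n x∈)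

triplesBelow-sound : ∀ n {w} → w ∈ triplesBelow n → weight w ≤₃ n
triplesBelow-sound zero                w∈ = flat-sound 0 w∈
triplesBelow-sound (suc zero)          w∈ = flat-sound 1 w∈
triplesBelow-sound (suc (suc zero))    w∈ = flat-sound 2 w∈
triplesBelow-sound (suc (suc (suc n))) w∈ with ∈-++⁻ (map flat (pairsBelow (3 ℕ.+ n))) w∈
... | inj₁ w∈flat = flat-sound (3 ℕ.+ n) w∈flat
... | inj₂ w∈inc with ∈-map⁻ incC w∈inc
...   | v , v∈ , refl = subst (_≤₃ 3 ℕ.+ n) (sym (weight-incC v)) (≤₃-3+ (triplesBelow-sound n v∈))

flat∈triplesBelow : ∀ n {x} → x ∈ pairsBelow n → flat x ∈ triplesBelow n
flat∈triplesBelow zero                x∈ = ∈-map⁺ flat x∈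
flat∈triplesBelow (suc zero)          x∈ = ∈-map⁺ flat x∈
flat∈triplesBelow (suc (suc zero))    x∈ = ∈-map⁺ flat x∈
flat∈triplesBelow (suc (suc (suc n))) x∈ = ∈-++⁺ˡ (∈-map⁺ flat x∈)

triplesBelow-complete : ∀ {w n} → weight w ≤₃ n → w ∈ triplesBelow n
triplesBelow-complete {a , b , zero} {n} w≤₃n =
  flat∈triplesBelow n (pairsBelow-complete (subst (_≤₃ n) (weight-flat (a , b)) w≤₃n))
triplesBelow-complete {a , b , suc c} (steps k refl) =
  subst (λ n → (a , b , suc c) ∈ triplesBelow n) (sym index)
    (∈-++⁺ʳ (map flat (pairsBelow (3 ℕ.+ m))) (∈-map⁺ incC (triplesBelow-complete (steps k refl))))
  where
  m = weight (a , b , c) ℕ.+ 3 ℕ.* k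
  index : weight (a , b , suc c) ℕ.+ 3 ℕ.* k ≡ 3 ℕ.+ m
  index = cong (ℕ._+ 3 ℕ.* k) (weight-incC (a , b , c))

triplesBelow-unique : ∀ n → Unique (triplesBelow n)
triplesBelow-unique zero                = Unique.map⁺ flat-injective (pairsBelow-unique 0)
triplesBelow-unique (suc zero)          = Unique.map⁺ flat-injective (pairsBelow-unique 1)
triplesBelow-unique (suc (suc zero))    = Unique.map⁺ flat-injective (pairsBelow-unique 2)
triplesBelow-unique (suc (suc (suc n))) = Unique.++⁺
  (Unique.map⁺ flat-injective (pairsBelow-unique (3 ℕ.+ n)))
  (Unique.map⁺ incC-injective (triplesBelow-unique n))
  disjoint
  where
  disjoint : ∀ {w} → ¬ (w ∈ map flat (pairsBelow (3 ℕ.+ n)) × w ∈ map incC (triplesBelow n))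
  disjoint (w∈flat , w∈inc) with ∈-map⁻ flat w∈flat | ∈-map⁻ incC w∈inc
  ... | _ , _ , refl | _ , _ , ()

triplesBelow-card : ∀ n → C≡ n (length (triplesBelow n))
triplesBelow-card n = triplesBelow n , triplesBelow-unique n , ∈⇔S , refl
  where
  ∈⇔S : ∀ w → w ∈ triplesBelow n ⇔ S n w
  ∈⇔S w = mk⇔ (λ w∈ → from (triplesBelow-sound n w∈)) (λ s → triplesBelow-complete (to s))
    where open Equivalence (S⇔weight≤₃ n w)

#pairsOfWeight #pairsBelow #triplesBelow : ℕ → ℕ
#pairsOfWeight n = length (pairsOfWeight n)
#pairsBelow    n = length (pairsBelow n)
#triplesBelow  n = length (triplesBelow n)

#pairsOfWeight-2+ : ∀ m → #pairsOfWeight (2 ℕ.+ m) ≡ suc (#pairsOfWeight m)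
#pairsOfWeight-2+ m = cong suc (length-map incB (pairsOfWeight m))

#pairsBelow-3+ : ∀ n → #pairsBelow (3 ℕ.+ n) ≡ #pairsOfWeight (3 ℕ.+ n) ℕ.+ #pairsBelow n
#pairsBelow-3+ n = length-++ (pairsOfWeight (3 ℕ.+ n))

#triplesBelow-3+ : ∀ n → #triplesBelow (3 ℕ.+ n) ≡ #pairsBelow (3 ℕ.+ n) ℕ.+ #triplesBelow n
#triplesBelow-3+ n = begin
  #triplesBelow (3 ℕ.+ n)
    ≡⟨ length-++ (map flat (pairsBelow (3 ℕ.+ n))) ⟩
  length (map flat (pairsBelow (3 ℕ.+ n))) ℕ.+ length (map incC (triplesBelow n))
    ≡⟨ cong₂ ℕ._+_ (length-map flat (pairsBelow (3 ℕ.+ n))) (length-map incC (triplesBelow n)) ⟩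
  #pairsBelow (3 ℕ.+ n) ℕ.+ #triplesBelow n                              ∎

#pairsOfWeight-3+ : ∀ m → #pairsOfWeight (3 ℕ.+ m) ℕ.+ #pairsOfWeight m ≡ 3 ℕ.+ m
#pairsOfWeight-3+ zero          = refl
#pairsOfWeight-3+ (suc zero)    = refl
#pairsOfWeight-3+ (suc (suc m)) = begin
  #pairsOfWeight (5 ℕ.+ m) ℕ.+ #pairsOfWeight (2 ℕ.+ m)     ≡⟨ cong₂ ℕ._+_ (#pairsOfWeight-2+ (3 ℕ.+ m)) (#pairsOfWeight-2+ m) ⟩
  suc (#pairsOfWeight (3 ℕ.+ m)) ℕ.+ suc (#pairsOfWeight m) ≡⟨ cong suc (ℕ.+-suc _ (#pairsOfWeight m)) ⟩
  2 ℕ.+ (#pairsOfWeight (3 ℕ.+ m) ℕ.+ #pairsOfWeight m)     ≡⟨ cong (2 ℕ.+_) (#pairsOfWeight-3+ m) ⟩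
  5 ℕ.+ m                                                    ∎

#pairsBelow-6+ : ∀ n → #pairsBelow (6 ℕ.+ n) ≡ 6 ℕ.+ n ℕ.+ #pairsBelow n
#pairsBelow-6+ n = begin
  #pairsBelow (6 ℕ.+ n)
    ≡⟨ #pairsBelow-3+ (3 ℕ.+ n) ⟩
  #pairsOfWeight (6 ℕ.+ n) ℕ.+ #pairsBelow (3 ℕ.+ n)
    ≡⟨ cong (#pairsOfWeight (6 ℕ.+ n) ℕ.+_) (#pairsBelow-3+ n) ⟩
  #pairsOfWeight (6 ℕ.+ n) ℕ.+ (#pairsOfWeight (3 ℕ.+ n) ℕ.+ #pairsBelow n)
    ≡⟨ ℕ.+-assoc (#pairsOfWeight (6 ℕ.+ n)) _ _ ⟨
  #pairsOfWeight (6 ℕ.+ n) ℕ.+ #pairsOfWeight (3 ℕ.+ n) ℕ.+ #pairsBelow n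
    ≡⟨ cong (ℕ._+ #pairsBelow n) (#pairsOfWeight-3+ (3 ℕ.+ n)) ⟩
  6 ℕ.+ n ℕ.+ #pairsBelow n
    ∎

6*suc : ∀ j r → 6 ℕ.* suc j ℕ.+ r ≡ 6 ℕ.+ (6 ℕ.* j ℕ.+ r)
6*suc = ℕ-Solver.solve-∀

pos-6*+ : ∀ j r → + (6 ℕ.* j ℕ.+ r) ≡ + 6 * + j + + r
pos-6*+ j r = trans (ℤ.pos-+ (6 ℕ.* j) r) (cong (_+ + r) (ℤ.pos-* 6 j))

#pairsBelow-closed : ∀ j r → + #pairsBelow (6 ℕ.* j ℕ.+ r) ≡ + #pairsBelow r + + j * (+ r + + 3 + + 3 * + j)
#pairsBelow-closed zero    r = base (+ #pairsBelow r) (+ r)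
  where
  base : ∀ A R → A ≡ A + + 0 * (R + + 3 + + 3 * + 0)
  base = ℤ-Solver.solve-∀
#pairsBelow-closed (suc j) r = begin
  + #pairsBelow (6 ℕ.* suc j ℕ.+ r)                       ≡⟨ cong (λ n → + #pairsBelow n) (6*suc j r) ⟩
  + #pairsBelow (6 ℕ.+ X)                                 ≡⟨ cong +_ (#pairsBelow-6+ X) ⟩
  + (6 ℕ.+ X ℕ.+ #pairsBelow X)                           ≡⟨ ℤ.pos-+ (6 ℕ.+ X) (#pairsBelow X) ⟩
  + (6 ℕ.+ X) + + #pairsBelow X
    ≡⟨ cong₂ _+_ (trans (ℤ.pos-+ 6 X) (cong (_+_ (+ 6)) (pos-6*+ j r))) (#pairsBelow-closed j r) ⟩
  + 6 + (+ 6 * + j + + r) + (+ #pairsBelow r + + j * (+ r + + 3 + + 3 * + j))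
                                                         ≡⟨ step (+ #pairsBelow r) (+ r) (+ j) ⟩
  + #pairsBelow r + + suc j * (+ r + + 3 + + 3 * + suc j) ∎
  where
  X = 6 ℕ.* j ℕ.+ r
  step : ∀ A R J →
    + 6 + (+ 6 * J + R) + (A + J * (R + + 3 + + 3 * J)) ≡ A + (+ 1 + J) * (R + + 3 + + 3 * (+ 1 + J))
  step = ℤ-Solver.solve-∀

#triplesBelow-6+ : ∀ j r → #triplesBelow (6 ℕ.* suc j ℕ.+ r) ≡
  #pairsBelow (6 ℕ.* suc j ℕ.+ r) ℕ.+ (#pairsBelow (6 ℕ.* j ℕ.+ (3 ℕ.+ r)) ℕ.+ #triplesBelow (6 ℕ.* j ℕ.+ r))
#triplesBelow-6+ j r = begin
  #triplesBelow (6 ℕ.* suc j ℕ.+ r)                  ≡⟨ cong #triplesBelow (6*suc j r) ⟩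
  #triplesBelow (6 ℕ.+ X)                            ≡⟨ #triplesBelow-3+ (3 ℕ.+ X) ⟩
  #pairsBelow (6 ℕ.+ X) ℕ.+ #triplesBelow (3 ℕ.+ X)   ≡⟨ cong (#pairsBelow (6 ℕ.+ X) ℕ.+_) (#triplesBelow-3+ X) ⟩
  #pairsBelow (6 ℕ.+ X) ℕ.+ (#pairsBelow (3 ℕ.+ X) ℕ.+ #triplesBelow X)
    ≡⟨ cong₂ (λ m n → #pairsBelow m ℕ.+ (#pairsBelow n ℕ.+ #triplesBelow X)) (sym (6*suc j r)) (shift j r) ⟩
  #pairsBelow (6 ℕ.* suc j ℕ.+ r) ℕ.+ (#pairsBelow (6 ℕ.* j ℕ.+ (3 ℕ.+ r)) ℕ.+ #triplesBelow X) ∎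
  where
  X = 6 ℕ.* j ℕ.+ r
  shift : ∀ j r → 3 ℕ.+ (6 ℕ.* j ℕ.+ r) ≡ 6 ℕ.* j ℕ.+ (3 ℕ.+ r)
  shift = ℕ-Solver.solve-∀

pos-+³ : ∀ x y z → + (x ℕ.+ (y ℕ.+ z)) ≡ + x + (+ y + + z)
pos-+³ x y z = trans (ℤ.pos-+ x (y ℕ.+ z)) (cong (_+_ (+ x)) (ℤ.pos-+ y z))

#triplesBelow-closed : ∀ j r → + 2 * + #triplesBelow (6 ℕ.* j ℕ.+ r) ≡
  + 2 * + #triplesBelow r
    + + j * (+ 2 * + #pairsBelow r + + 2 * + #pairsBelow (3 ℕ.+ r) - + 1 + (+ 9 + + 2 * + r) * + j + + 4 * + j * + j)
#triplesBelow-closed zero    r = base (+ #triplesBelow r) (+ #pairsBelow r) (+ #pairsBelow (3 ℕ.+ r)) (+ r)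
  where
  base : ∀ T A A′ R →
    + 2 * T ≡ + 2 * T + + 0 * (+ 2 * A + + 2 * A′ - + 1 + (+ 9 + + 2 * R) * + 0 + + 4 * + 0 * + 0)
  base = ℤ-Solver.solve-∀
#triplesBelow-closed (suc j) r = begin
  + 2 * + #triplesBelow (6 ℕ.* suc j ℕ.+ r)  ≡⟨ cong (λ n → + 2 * + n) (#triplesBelow-6+ j r) ⟩
  + 2 * + (m₁ ℕ.+ (m₂ ℕ.+ t₀))              ≡⟨ cong (_*_ (+ 2)) (pos-+³ m₁ m₂ t₀) ⟩
  + 2 * (+ m₁ + (+ m₂ + + t₀))              ≡⟨ distrib (+ m₁) (+ m₂) (+ t₀) ⟩
  + 2 * + m₁ + + 2 * + m₂ + + 2 * + t₀
    ≡⟨ cong₂ _+_ (cong₂ (λ x y → + 2 * x + + 2 * y) (#pairsBelow-closed (suc j) r) (#pairsBelow-closed j (3 ℕ.+ r)))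
                 (#triplesBelow-closed j r) ⟩
  + 2 * (A + + suc j * (+ r + + 3 + + 3 * + suc j)) + + 2 * (A′ + + j * (+ 3 + + r + + 3 + + 3 * + j))
    + (+ 2 * T + + j * (+ 2 * A + + 2 * A′ - + 1 + (+ 9 + + 2 * + r) * + j + + 4 * + j * + j))
    ≡⟨ step T A A′ (+ r) (+ j) ⟩
  + 2 * T + + suc j * (+ 2 * A + + 2 * A′ - + 1 + (+ 9 + + 2 * + r) * + suc j + + 4 * + suc j * + suc j) ∎
  where
  m₁ = #pairsBelow (6 ℕ.* suc j ℕ.+ r)
  m₂ = #pairsBelow (6 ℕ.* j ℕ.+ (3 ℕ.+ r))
  t₀ = #triplesBelow (6 ℕ.* j ℕ.+ r)
  T  = + #triplesBelow r
  A  = + #pairsBelow r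
  A′ = + #pairsBelow (3 ℕ.+ r)
  distrib : ∀ x y t → + 2 * (x + (y + t)) ≡ + 2 * x + + 2 * y + + 2 * t
  distrib = ℤ-Solver.solve-∀
  step : ∀ T A A′ R J →
    + 2 * (A + (+ 1 + J) * (R + + 3 + + 3 * (+ 1 + J))) + + 2 * (A′ + J * (+ 3 + R + + 3 + + 3 * J))
      + (+ 2 * T + J * (+ 2 * A + + 2 * A′ - + 1 + (+ 9 + + 2 * R) * J + + 4 * J * J))
    ≡ + 2 * T + (+ 1 + J) * (+ 2 * A + + 2 * A′ - + 1 + (+ 9 + + 2 * R) * (+ 1 + J) + + 4 * (+ 1 + J) * (+ 1 + J))
  step = ℤ-Solver.solve-∀

sixteen-#triplesBelow : ∀ {n} j r → n ≡ 6 ℕ.* j ℕ.+ r → + 16 * + #triplesBelow n ≡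
  + 8 * (+ 2 * + #triplesBelow r
           + + j * (+ 2 * + #pairsBelow r + + 2 * + #pairsBelow (3 ℕ.+ r) - + 1 + (+ 9 + + 2 * + r) * + j + + 4 * + j * + j))
sixteen-#triplesBelow j r refl =
  trans (ℤ.*-assoc (+ 8) (+ 2) (+ #triplesBelow (6 ℕ.* j ℕ.+ r))) (cong (_*_ (+ 8)) (#triplesBelow-closed j r))

parity : ∀ n → Σ ℕ λ j → n ≡ 2 ℕ.* j ⊎ n ≡ suc (2 ℕ.* j)
parity zero = 0 , inj₁ refl
parity (suc n) with parity n
... | j , inj₁ refl = j , inj₂ refl
... | j , inj₂ refl = suc j , inj₁ (cong suc (sym (ℕ.+-suc j (j ℕ.+ 0))))

sign-even : ∀ j → (- + 1) ^ (2 ℕ.* j) ≡ + 1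
sign-even j = trans (sym (ℤ.^-*-assoc (- + 1) 2 j)) (ℤ.^-zeroˡ j)

Components : ℕ → ℤ → ℤ → Set
Components n i s =
  (+ 16 * + #triplesBelow n ≡ + 2 * ((i + + 1) * (+ 2 * i * i + i + + 1)) - (+ 1 + s))
  × (+ 16 * + #triplesBelow (n ℕ.+ 1) ≡ + 2 * ((i + + 1) * (+ 2 * i * i + + 3 * i - + 1)) + (+ 1 + s))
  × (+ 16 * + #triplesBelow (n ℕ.+ 2) ≡ + 2 * ((i + + 1) * (+ 2 * i * i + + 5 * i + + 1)) - (+ 1 + s))

-- The numerals on the left of formulaᵣ are the coefficients of #triplesBelow-closed at r = 0, 1, 2
-- (below: r = 3, 4, 5), computed from #triplesBelow r ∈ 1,1,2,4,5,7 and #pairsBelow r ∈ 1,1,2,3,4,5,7,8,10.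
odd-components : ∀ j → Components (3 ℕ.* (2 ℕ.* j)) (+ 1 + + 2 * + j) (- + 1)
odd-components j =
    trans (sixteen-#triplesBelow j 0 (index₀ j)) (formula₀ (+ j))
  , trans (sixteen-#triplesBelow j 1 (index j 1)) (formula₁ (+ j))
  , trans (sixteen-#triplesBelow j 2 (index j 2)) (formula₂ (+ j))
  where
  index₀ : ∀ j → 3 ℕ.* (2 ℕ.* j) ≡ 6 ℕ.* j ℕ.+ 0
  index₀ = ℕ-Solver.solve-∀
  index : ∀ j ρ → 3 ℕ.* (2 ℕ.* j) ℕ.+ ρ ≡ 6 ℕ.* j ℕ.+ ρ
  index = ℕ-Solver.solve-∀
  formula₀ : ∀ J → + 8 * (+ 2 + J * (+ 7 + + 9 * J + + 4 * J * J))
    ≡ + 2 * ((+ 1 + + 2 * J + + 1) * (+ 2 * (+ 1 + + 2 * J) * (+ 1 + + 2 * J) + (+ 1 + + 2 * J) + + 1)) - (+ 1 + - + 1)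
  formula₀ = ℤ-Solver.solve-∀
  formula₁ : ∀ J → + 8 * (+ 2 + J * (+ 9 + + 11 * J + + 4 * J * J))
    ≡ + 2 * ((+ 1 + + 2 * J + + 1) * (+ 2 * (+ 1 + + 2 * J) * (+ 1 + + 2 * J) + + 3 * (+ 1 + + 2 * J) - + 1)) + (+ 1 + - + 1)
  formula₁ = ℤ-Solver.solve-∀
  formula₂ : ∀ J → + 8 * (+ 4 + J * (+ 13 + + 13 * J + + 4 * J * J))
    ≡ + 2 * ((+ 1 + + 2 * J + + 1) * (+ 2 * (+ 1 + + 2 * J) * (+ 1 + + 2 * J) + + 5 * (+ 1 + + 2 * J) + + 1)) - (+ 1 + - + 1)
  formula₂ = ℤ-Solver.solve-∀

even-components : ∀ j → Components (3 ℕ.* suc (2 ℕ.* j)) (+ 2 + + 2 * + j) (+ 1)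
even-components j =
    trans (sixteen-#triplesBelow j 3 (index₀ j)) (formula₀ (+ j))
  , trans (sixteen-#triplesBelow j 4 (index j 1)) (formula₁ (+ j))
  , trans (sixteen-#triplesBelow j 5 (index j 2)) (formula₂ (+ j))
  where
  index₀ : ∀ j → 3 ℕ.* suc (2 ℕ.* j) ≡ 6 ℕ.* j ℕ.+ 3
  index₀ = ℕ-Solver.solve-∀
  index : ∀ j ρ → 3 ℕ.* suc (2 ℕ.* j) ℕ.+ ρ ≡ 6 ℕ.* j ℕ.+ (3 ℕ.+ ρ)
  index = ℕ-Solver.solve-∀
  formula₀ : ∀ J → + 8 * (+ 8 + J * (+ 19 + + 15 * J + + 4 * J * J))
    ≡ + 2 * ((+ 2 + + 2 * J + + 1) * (+ 2 * (+ 2 + + 2 * J) * (+ 2 + + 2 * J) + (+ 2 + + 2 * J) + + 1)) - (+ 1 + + 1)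
  formula₀ = ℤ-Solver.solve-∀
  formula₁ : ∀ J → + 8 * (+ 10 + J * (+ 23 + + 17 * J + + 4 * J * J))
    ≡ + 2 * ((+ 2 + + 2 * J + + 1) * (+ 2 * (+ 2 + + 2 * J) * (+ 2 + + 2 * J) + + 3 * (+ 2 + + 2 * J) - + 1)) + (+ 1 + + 1)
  formula₁ = ℤ-Solver.solve-∀
  formula₂ : ∀ J → + 8 * (+ 14 + J * (+ 29 + + 19 * J + + 4 * J * J))
    ≡ + 2 * ((+ 2 + + 2 * J + + 1) * (+ 2 * (+ 2 + + 2 * J) * (+ 2 + + 2 * J) + + 5 * (+ 2 + + 2 * J) + + 1)) - (+ 1 + + 1)
  formula₂ = ℤ-Solver.solve-∀

components : ∀ i → Components (3 ℕ.* i) (+ suc i) ((- + 1) ^ suc i)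
components i with parity i
... | j , inj₁ refl = subst₂ (Components (3 ℕ.* (2 ℕ.* j)))
  (cong (_+_ (+ 1)) (sym (ℤ.pos-* 2 j))) (cong (_*_ (- + 1)) (sym (sign-even j))) (odd-components j)
... | j , inj₂ refl = subst₂ (Components (3 ℕ.* suc (2 ℕ.* j)))
  (cong (_+_ (+ 2)) (sym (ℤ.pos-* 2 j))) (cong (λ s → - + 1 * (- + 1 * s)) (sym (sign-even j))) (even-components j)

corollary3p13 : (i : ℕ) → 1 ≤ i →
    Σ ℕ (λ c → C≡ (3 Data.Nat.* (i ∸ 1)) c ×
    (+ 16 * + c ≡ + 2 * ((+ i + + 1) * (+ 2 * + i * + i + + i + + 1)) - (+ 1 + (- + 1) ^ i)))
    × Σ ℕ (λ c → C≡ (3 Data.Nat.* (i ∸ 1) Data.Nat.+ 1) c ×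
    (+ 16 * + c ≡ + 2 * ((+ i + + 1) * (+ 2 * + i * + i + + 3 * + i - + 1)) + (+ 1 + (- + 1) ^ i)))
    × Σ ℕ (λ c → C≡ (3 Data.Nat.* (i ∸ 1) Data.Nat.+ 2) c ×
    (+ 16 * + c ≡ + 2 * ((+ i + + 1) * (+ 2 * + i * + i + + 5 * + i + + 1)) - (+ 1 + (- + 1) ^ i)))
corollary3p13 zero    ()
corollary3p13 (suc i) _ with components i
... | C₀ , C₁ , C₂ = (_ , triplesBelow-card _ , C₀) , (_ , triplesBelow-card _ , C₁) , (_ , triplesBelow-card _ , C₂)
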